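{- The relation $\triangleright$ on erased terms in normal form is well-founded: there is no infinite sequence $t_1\triangleright t_2\triangleright t_3\triangleright\cdots$.
   Context: Erased terms $t::=x\mid f\mid\lambda x.t\mid t\,u\mid\mathsf{Leaf}\mid\mathsf{Node}$; normal forms are with respect to a fixed reduction relation (closure of $\beta$ and a finite set of rewrite rules). A term is neutral if it is not of the form $\lambda x.t$, $\mathsf{Node}\,t\,u$ or $\mathsf{Leaf}$. On normal forms, $\triangleright$ and $\trianglerighteq$ are defined mutually by: $t_1\trianglerighteq u\Rightarrow\mathsf{Node}\,t_1\,t_2\triangleright u$; $t_2\trianglerighteq u\Rightarrow\mathsf{Node}\,t_1\,t_2\triangleright u$; $t_1\triangleright u_1\wedge t_2\trianglerighteq u_2\Rightarrow\mathsf{Node}\,t_1t_2\triangleright\mathsf{Node}\,u_1u_2$; $t_1\trianglerighteq u_1\wedge t_2\triangleright u_2\Rightarrow\mathsf{Node}\,t_1t_2\triangleright\mathsf{Node}\,u_1u_2$; $\mathsf{Leaf}\trianglerighteq\mathsf{Leaf}$; $t\trianglerighteq u$ whenever $t$ and $u$ are both neutral; $t\triangleright u\Rightarrow t\trianglerighteq u$. -}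

module Defs where

open import Data.Nat using (ℕ; zero; suc)
open import Data.Product using (Σ; _×_; _,_; ∃)
open import Data.List using (List)
open import Data.List.Membership.Propositional using (_∈_)
open import Relation.Nullary using (¬_)
open import Relation.Binary.PropositionalEquality using (_≡_)

data Term : Set where
  var  : ℕ → Term
  fun  : ℕ → Term
  lam  : Term → Term
  app  : Term → Term → Term
  Leaf : Term
  Node : Term

NodeT : Term → Term → Term
NodeT t u = app (app Node t) u

ext : (ℕ → ℕ) → ℕ → ℕ
ext ρ zero    = zero
ext ρ (suc n) = suc (ρ n)

rename : (ℕ → ℕ) → Term → Term
rename ρ (var x)   = var (ρ x)
rename ρ (fun f)   = fun f
rename ρ (lam t)   = lam (rename (ext ρ) t)
rename ρ (app t u) = app (rename ρ t) (rename ρ u)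
rename ρ Leaf      = Leaf
rename ρ Node      = Node

exts : (ℕ → Term) → ℕ → Term
exts σ zero    = var zero
exts σ (suc n) = rename suc (σ n)

subst : (ℕ → Term) → Term → Term
subst σ (var x)   = σ x
subst σ (fun f)   = fun f
subst σ (lam t)   = lam (subst (exts σ) t)
subst σ (app t u) = app (subst σ t) (subst σ u)
subst σ Leaf      = Leaf
subst σ Node      = Node

single : Term → ℕ → Term
single u zero    = u
single u (suc n) = var n

-- A rewrite rule is a pair (lhs , rhs); its free variables act as pattern
-- variables, instantiated by an arbitrary substitution.
Rule : Set
Rule = Term × Term

data _⊢_⟶_ (rules : List Rule) : Term → Term → Set where
  β     : ∀ {t u} → rules ⊢ app (lam t) u ⟶ subst (single u) t
  rule  : ∀ {l r} (σ : ℕ → Term) → (l , r) ∈ rules →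
          rules ⊢ subst σ l ⟶ subst σ r
  ξlam  : ∀ {t t'} → rules ⊢ t ⟶ t' → rules ⊢ lam t ⟶ lam t'
  ξappˡ : ∀ {t t' u} → rules ⊢ t ⟶ t' → rules ⊢ app t u ⟶ app t' u
  ξappʳ : ∀ {t u u'} → rules ⊢ u ⟶ u' → rules ⊢ app t u ⟶ app t u'

Normal : List Rule → Term → Set
Normal rules t = ¬ (∃ λ u → rules ⊢ t ⟶ u)

Neutral : Term → Set
Neutral t = (∀ s → ¬ (t ≡ lam s)) × (∀ a b → ¬ (t ≡ NodeT a b)) × ¬ (t ≡ Leaf)

mutual
  data _▷_ : Term → Term → Set where
    sub₁  : ∀ {t₁ t₂ u} → t₁ ⊵ u → NodeT t₁ t₂ ▷ u
    sub₂  : ∀ {t₁ t₂ u} → t₂ ⊵ u → NodeT t₁ t₂ ▷ u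
    node₁ : ∀ {t₁ t₂ u₁ u₂} → t₁ ▷ u₁ → t₂ ⊵ u₂ → NodeT t₁ t₂ ▷ NodeT u₁ u₂
    node₂ : ∀ {t₁ t₂ u₁ u₂} → t₁ ⊵ u₁ → t₂ ▷ u₂ → NodeT t₁ t₂ ▷ NodeT u₁ u₂

  data _⊵_ : Term → Term → Set where
    leaf    : Leaf ⊵ Leaf
    neutral : ∀ {t u} → Neutral t → Neutral u → t ⊵ u
    strict  : ∀ {t u} → t ▷ u → t ⊵ u

-- Normal forms as a type, and ▷ on them, oriented for WellFounded
-- (the "smaller" element is the right-hand side of ▷).
NF : List Rule → Set
NF rules = Σ Term (Normal rules)

_◁ₙ_ : ∀ {rules} → NF rules → NF rules → Set
(u , _) ◁ₙ (t , _) = t ▷ u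

-- Every ▷-step strictly decreases the number of Node constructors reachable
-- from the root through Node arguments, and ⊵ does not increase it: a neutral
-- term has none, and the remaining cases follow the constructors of ▷.
module Submission where

open import Defs
open import Data.List using (List)
open import Data.Nat using (ℕ; zero; suc; _+_; _≤_; _<_; z≤n; s≤s)
open import Data.Nat.Properties using (≤-trans; m≤m+n; m≤n+m; +-mono-<-≤; +-mono-≤-<; <⇒≤)
open import Data.Nat.Induction using (<-wellFounded)
open import Data.Product using (_,_; proj₁)
open import Data.Empty using (⊥-elim)
open import Function using (flip)
open import Induction.WellFounded using (WellFounded; module Subrelation)
open import Relation.Binary.Construct.On as On using ()
open import Relation.Binary.PropositionalEquality using (_≡_; refl)

nodeSize : Term → ℕ
nodeSize (app (app Node a) b) = suc (nodeSize a + nodeSize b)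
nodeSize _                    = zero

Neutral⇒nodeSize≡0 : ∀ {t} → Neutral t → nodeSize t ≡ 0
Neutral⇒nodeSize≡0 {app (app Node a) b} (_ , notNode , _) = ⊥-elim (notNode a b refl)
Neutral⇒nodeSize≡0 {app (app (var _) _) _} _ = refl
Neutral⇒nodeSize≡0 {app (app (fun _) _) _} _ = refl
Neutral⇒nodeSize≡0 {app (app (lam _) _) _} _ = refl
Neutral⇒nodeSize≡0 {app (app (app _ _) _) _} _ = refl
Neutral⇒nodeSize≡0 {app (app Leaf _) _} _ = refl
Neutral⇒nodeSize≡0 {app (var _) _} _ = refl
Neutral⇒nodeSize≡0 {app (fun _) _} _ = refl
Neutral⇒nodeSize≡0 {app (lam _) _} _ = refl
Neutral⇒nodeSize≡0 {app Leaf _} _ = refl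
Neutral⇒nodeSize≡0 {app Node _} _ = refl
Neutral⇒nodeSize≡0 {var _} _ = refl
Neutral⇒nodeSize≡0 {fun _} _ = refl
Neutral⇒nodeSize≡0 {lam _} _ = refl
Neutral⇒nodeSize≡0 {Leaf} _ = refl
Neutral⇒nodeSize≡0 {Node} _ = refl

mutual
  ▷⇒nodeSize-< : ∀ {t u} → t ▷ u → nodeSize u < nodeSize t
  ▷⇒nodeSize-< (sub₁ {t₁} {t₂} p)  = s≤s (≤-trans (⊵⇒nodeSize-≤ p) (m≤m+n (nodeSize t₁) (nodeSize t₂)))
  ▷⇒nodeSize-< (sub₂ {t₁} {t₂} p)  = s≤s (≤-trans (⊵⇒nodeSize-≤ p) (m≤n+m (nodeSize t₂) (nodeSize t₁)))
  ▷⇒nodeSize-< (node₁ p q) = s≤s (+-mono-<-≤ (▷⇒nodeSize-< p) (⊵⇒nodeSize-≤ q))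
  ▷⇒nodeSize-< (node₂ p q) = s≤s (+-mono-≤-< (⊵⇒nodeSize-≤ p) (▷⇒nodeSize-< q))

  ⊵⇒nodeSize-≤ : ∀ {t u} → t ⊵ u → nodeSize u ≤ nodeSize t
  ⊵⇒nodeSize-≤ leaf            = z≤n
  ⊵⇒nodeSize-≤ (neutral _ nu) rewrite Neutral⇒nodeSize≡0 nu = z≤n
  ⊵⇒nodeSize-≤ (strict p)      = <⇒≤ (▷⇒nodeSize-< p)

▷-wellFounded : WellFounded (flip _▷_)
▷-wellFounded = Subrelation.wellFounded ▷⇒nodeSize-< (On.wellFounded nodeSize <-wellFounded)

mainTheorem8 : (rules : List Rule) → WellFounded (_◁ₙ_ {rules})
mainTheorem8 rules = On.wellFounded proj₁ ▷-wellFounded
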